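{- Let $G=(V,E)$ be a loop-free multigraph with $n=|V|$ and let $\eta_n=\sum_{i=1}^n \frac1i$. Every vertex order $\sigma$ produced by the greedy algorithm (with any tie-breaking) satisfies $\sum_{v\in V}\overleftarrow{d}_\sigma(v)^2\le 4\eta_n\cdot \min_{\tau}\sum_{v\in V}\overleftarrow{d}_\tau(v)^2$, the minimum being over all vertex orders $\tau$ of $G$.
   Context: A vertex order is a linear ordering $\sigma=(\sigma_1,\dots,\sigma_n)$ of $V$; the left-degree $\overleftarrow{d}_\sigma(v)$ of $v=\sigma_i$ is the number of edges (with multiplicity) joining $v$ to $\{\sigma_1,\dots,\sigma_{i-1}\}$. The greedy algorithm builds the order from right to left: repeatedly, it picks a vertex of minimum degree in the current (remaining) graph, places it at the last still-free position, and deletes it from the graph. -}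

module Defs where

open import Data.Nat using (ℕ; zero; suc; _+_; _^_)
open import Data.Fin using (Fin; zero; suc; toℕ; _<?_; _≤?_)
open import Data.Fin.Permutation using (Permutation′; _⟨$⟩ʳ_; _⟨$⟩ˡ_)
open import Data.Integer using (+_)
open import Data.Rational using (ℚ; 0ℚ; _/_)
import Data.Rational as ℚ
open import Data.Bool using (if_then_else_)
open import Relation.Nullary.Decidable using (⌊_⌋)
open import Relation.Binary.PropositionalEquality using (_≡_)

∑ : (n : ℕ) → (Fin n → ℕ) → ℕ
∑ zero    f = 0
∑ (suc n) f = f zero + ∑ n (λ i → f (suc i))

record Multigraph (n : ℕ) : Set where
  field
    mult      : Fin n → Fin n → ℕ
    symmetric : ∀ u v → mult u v ≡ mult v u
    loopFree  : ∀ v → mult v v ≡ 0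
open Multigraph public

-- A vertex order: σ ⟨$⟩ʳ i is the vertex at position i (σ_i),
-- σ ⟨$⟩ˡ v is the position of vertex v.
VertexOrder : ℕ → Set
VertexOrder n = Permutation′ n

leftDeg : ∀ {n} → Multigraph n → VertexOrder n → Fin n → ℕ
leftDeg {n} G σ v =
  ∑ n (λ j → if ⌊ j <? (σ ⟨$⟩ˡ v) ⌋ then mult G (σ ⟨$⟩ʳ j) v else 0)

remDeg : ∀ {n} → Multigraph n → VertexOrder n → Fin n → Fin n → ℕ
remDeg {n} G σ i w =
  ∑ n (λ k → if ⌊ k ≤? i ⌋ then mult G (σ ⟨$⟩ʳ k) w else 0)

-- σ is producible by the greedy algorithm (with some tie-breaking):
-- when position i is filled, the remaining graph is induced by the vertices
-- at positions ≤ i, and σ_i has minimum degree among them.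
IsGreedy : ∀ {n} → Multigraph n → VertexOrder n → Set
IsGreedy {n} G σ =
  ∀ (i j : Fin n) → toℕ j Data.Nat.≤ toℕ i →
    remDeg G σ i (σ ⟨$⟩ʳ i) Data.Nat.≤ remDeg G σ i (σ ⟨$⟩ʳ j)

cost : ∀ {n} → Multigraph n → VertexOrder n → ℕ
cost {n} G σ = ∑ n (λ v → leftDeg G σ v ^ 2)

η : ℕ → ℚ
η zero    = 0ℚ
η (suc n) = η n ℚ.+ ((+ 1) / suc n)

toℚ : ℕ → ℚ
toℚ k = (+ k) / 1

{-# OPTIONS --safe #-}
module Submission where

-- Let d_i be the degree of σ_i in the graph G[S_i] induced by S_i = {σ_0, …, σ_i}, which is what
-- greedy sees when it fixes σ_i: the left degree of σ_i is at most d_i, and d_i is the minimum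
-- degree of G[S_i]. For any order τ every edge of G[S_i] is counted in the τ-left degree of its
-- later endpoint, so (i + 1) d_i ≤ 2 |E(S_i)| ≤ 2 ∑_{v ∈ S_i} ℓ_τ(v), and by Cauchy–Schwarz
-- (∑_{v ∈ S_i} ℓ_τ(v))² ≤ (i + 1) cost(τ). Hence (i + 1) d_i² ≤ 4 cost(τ), and summing
-- d_i² ≤ 4 cost(τ) / (i + 1) over all positions i gives the factor 4 η_n.

open import Defs
open import Data.Nat using (ℕ)

module LeftDegrees where
  open import Data.Bool using (Bool; true; false; T; if_then_else_)
  open import Data.Empty using (⊥-elim)
  open import Data.Fin using (Fin; zero; suc; toℕ; _<_; _<?_; _≤?_)
  import Data.Fin.Properties as Fin
  open import Data.Fin.Permutation as Perm using (_⟨$⟩ʳ_; _⟨$⟩ˡ_)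
  open import Data.Nat using (zero; suc; _+_; _*_; _^_; _≤_; z≤n; s≤s; s≤s⁻¹)
  open import Data.Nat.Properties hiding (_<?_; _≤?_)
  open import Data.Nat.Tactic.RingSolver using (solve-∀)
  open import Algebra.Properties.CommutativeSemigroup *-commutativeSemigroup using (x∙yz≈y∙xz)
  open import Algebra.Properties.Semiring.Sum +-*-semiring
    using (sum; sum-cong-≗; sum-replicate-zero; ∑-distrib-+; ∑-comm; ∑-permute;
           *-distribˡ-sum; *-distribʳ-sum)
  open import Data.Product using (_,_)
  open import Data.Sum using ([_,_]′)
  open import Function using (_∘_; _⇔_; mk⇔)
  open import Relation.Binary.PropositionalEquality
    using (_≡_; refl; sym; trans; cong; cong₂; subst; subst₂)
  open import Relation.Nullary.Decidable
    using (Dec; yes; no; ⌊_⌋; toWitness; fromWitness; does-⇔; isYes≗does)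
  open ≤-Reasoning

  ∑≡sum : ∀ n (f : Fin n → ℕ) → ∑ n f ≡ sum f
  ∑≡sum zero    f = refl
  ∑≡sum (suc n) f = cong (f zero +_) (∑≡sum n (f ∘ suc))

  sum-mono-≤ : ∀ {n} {f g : Fin n → ℕ} → (∀ i → f i ≤ g i) → sum f ≤ sum g
  sum-mono-≤ {zero}  f≤g = z≤n
  sum-mono-≤ {suc n} f≤g = +-mono-≤ (f≤g zero) (sum-mono-≤ (f≤g ∘ suc))

  sum₂ : ∀ {n} → (Fin n → Fin n → ℕ) → ℕ
  sum₂ P = sum (λ i → sum (P i))

  sum₂-mono-≤ : ∀ {n} {P Q : Fin n → Fin n → ℕ} → (∀ i j → P i j ≤ Q i j) → sum₂ P ≤ sum₂ Q
  sum₂-mono-≤ P≤Q = sum-mono-≤ (λ i → sum-mono-≤ (P≤Q i))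

  sum-*-sum : ∀ {n} (f g : Fin n → ℕ) → sum f * sum g ≡ sum₂ (λ i j → f i * g j)
  sum-*-sum f g = trans (*-distribʳ-sum (sum g) f) (sum-cong-≗ (λ i → *-distribˡ-sum (f i) g))

  sum₂-+-transpose : ∀ {n} (P : Fin n → Fin n → ℕ) → sum₂ (λ i j → P i j + P j i) ≡ 2 * sum₂ P
  sum₂-+-transpose P = begin-equality
    sum (λ i → sum (λ j → P i j + P j i))
      ≡⟨ sum-cong-≗ (λ i → ∑-distrib-+ (P i) (λ j → P j i)) ⟩
    sum (λ i → sum (P i) + sum (λ j → P j i))
      ≡⟨ ∑-distrib-+ (λ i → sum (P i)) (λ i → sum (λ j → P j i)) ⟩
    sum₂ P + sum (λ i → sum (λ j → P j i))
      ≡⟨ cong (sum₂ P +_) (∑-comm (λ i j → P j i)) ⟩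
    sum₂ P + sum₂ P
      ≡⟨ cong (sum₂ P +_) (+-identityʳ (sum₂ P)) ⟨
    2 * sum₂ P ∎

  2*m*n≤m*m+n*n : ∀ m n → 2 * (m * n) ≤ m * m + n * n
  2*m*n≤m*m+n*n m n = [ ordered , flipped ]′ (≤-total m n)
    where
    expand : ∀ m k → 2 * (m * (m + k)) + k * k ≡ m * m + (m + k) * (m + k)
    expand = solve-∀
    ordered : ∀ {m n} → m ≤ n → 2 * (m * n) ≤ m * m + n * n
    ordered {m} m≤n with k , refl ← m≤n⇒∃[o]m+o≡n m≤n =
      ≤-trans (m≤m+n _ (k * k)) (≤-reflexive (expand m k))
    flipped : n ≤ m → 2 * (m * n) ≤ m * m + n * n
    flipped n≤m = subst₂ _≤_ (cong (2 *_) (*-comm n m)) (+-comm (n * n) (m * m)) (ordered n≤m)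

  cauchy-schwarz : ∀ {n} (a x : Fin n → ℕ) →
    sum (λ i → a i * x i) * sum (λ i → a i * x i) ≤ sum a * sum (λ i → a i * (x i * x i))
  cauchy-schwarz {n} a x = *-cancelˡ-≤ 2 (begin
    2 * (sum ax * sum ax)                   ≡⟨ cong (2 *_) (sum-*-sum ax ax) ⟩
    2 * sum₂ (λ i j → ax i * ax j)          ≡⟨ *-distribˡ-sum₂ ⟩
    sum₂ (λ i j → 2 * (ax i * ax j))        ≤⟨ sum₂-mono-≤ pointwise ⟩
    sum₂ (λ i j → q i * a j + q j * a i)    ≡⟨ sum₂-+-transpose (λ i j → q i * a j) ⟩
    2 * sum₂ (λ i j → q i * a j)            ≡⟨ cong (2 *_) (sum-*-sum q a) ⟨
    2 * (sum q * sum a)                     ≡⟨ cong (2 *_) (*-comm (sum q) (sum a)) ⟩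
    2 * (sum a * sum q)                     ∎)
    where
    ax q : Fin n → ℕ
    ax i = a i * x i
    q i = a i * (x i * x i)
    *-distribˡ-sum₂ : 2 * sum₂ (λ i j → ax i * ax j) ≡ sum₂ (λ i j → 2 * (ax i * ax j))
    *-distribˡ-sum₂ = trans (*-distribˡ-sum 2 (λ i → sum (λ j → ax i * ax j)))
                            (sum-cong-≗ (λ i → *-distribˡ-sum 2 (λ j → ax i * ax j)))
    rearrange : ∀ a b x y → a * b * (2 * (x * y)) ≡ 2 * ((a * x) * (b * y))
    rearrange = solve-∀
    expand : ∀ a b x y → a * b * (x * x + y * y) ≡ a * (x * x) * b + b * (y * y) * a
    expand = solve-∀
    pointwise : ∀ i j → 2 * (ax i * ax j) ≤ q i * a j + q j * a i
    pointwise i j = subst₂ _≤_ (rearrange (a i) (a j) (x i) (x j)) (expand (a i) (a j) (x i) (x j))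
      (*-monoʳ-≤ (a i * a j) (2*m*n≤m*m+n*n (x i) (x j)))

  m*d≤2*l⇒l*l≤m*c⇒m*[d*d]≤4*c : ∀ m d l c → m * d ≤ 2 * l → l * l ≤ m * c → m * (d * d) ≤ 4 * c
  m*d≤2*l⇒l*l≤m*c⇒m*[d*d]≤4*c zero      d l c _     _     = z≤n
  m*d≤2*l⇒l*l≤m*c⇒m*[d*d]≤4*c m@(suc _) d l c md≤2l ll≤mc = *-cancelˡ-≤ m (begin
    m * (m * (d * d))  ≡⟨ *-assoc m m (d * d) ⟨
    (m * m) * (d * d)  ≡⟨ [m*n]*[o*p]≡[m*o]*[n*p] m m d d ⟩
    (m * d) * (m * d)  ≤⟨ *-mono-≤ md≤2l md≤2l ⟩
    (2 * l) * (2 * l)  ≡⟨ [m*n]*[o*p]≡[m*o]*[n*p] 2 l 2 l ⟩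
    4 * (l * l)        ≤⟨ *-monoʳ-≤ 4 ll≤mc ⟩
    4 * (m * c)        ≡⟨ x∙yz≈y∙xz 4 m c ⟩
    m * (4 * c)        ∎)

  𝟙 : Bool → ℕ
  𝟙 true  = 1
  𝟙 false = 0

  if≡𝟙* : ∀ b m → (if b then m else 0) ≡ 𝟙 b * m
  if≡𝟙* true  m = sym (*-identityˡ m)
  if≡𝟙* false m = refl

  𝟙*m≤m : ∀ b m → 𝟙 b * m ≤ m
  𝟙*m≤m true  m = ≤-reflexive (*-identityˡ m)
  𝟙*m≤m false m = z≤n

  𝟙-mono : ∀ {b c} → (T b → T c) → 𝟙 b ≤ 𝟙 c
  𝟙-mono {false}        b⇒c = z≤n
  𝟙-mono {true} {true}  b⇒c = ≤-refl
  𝟙-mono {true} {false} b⇒c = ⊥-elim (b⇒c _)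

  𝟙*-monoʳ-≤ : ∀ b {m n} → (T b → m ≤ n) → 𝟙 b * m ≤ 𝟙 b * n
  𝟙*-monoʳ-≤ true  m≤n = *-monoʳ-≤ 1 (m≤n _)
  𝟙*-monoʳ-≤ false m≤n = z≤n

  ⌊⌋-cong : ∀ {A B : Set} → A ⇔ B → (a? : Dec A) (b? : Dec B) → ⌊ a? ⌋ ≡ ⌊ b? ⌋
  ⌊⌋-cong A⇔B a? b? = trans (isYes≗does a?) (trans (does-⇔ A⇔B a? b?) (sym (isYes≗does b?)))

  count-≤ : ∀ {n} (i : Fin n) → sum (λ (k : Fin n) → 𝟙 ⌊ k ≤? i ⌋) ≡ suc (toℕ i)
  count-≤ {suc n} zero    = cong suc (sum-replicate-zero n)
  count-≤ {suc n} (suc i) = cong suc (trans (sum-cong-≗ shift) (count-≤ i))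
    where
    shift : ∀ (k : Fin n) → 𝟙 ⌊ suc k ≤? suc i ⌋ ≡ 𝟙 ⌊ k ≤? i ⌋
    shift k = cong 𝟙 (⌊⌋-cong (mk⇔ s≤s⁻¹ s≤s) (suc k ≤? suc i) (k ≤? i))

  size : ∀ {n} → (Fin n → Bool) → ℕ
  size S = sum (𝟙 ∘ S)

  before : ∀ {n} → VertexOrder n → Fin n → Fin n → Bool
  before τ w u = ⌊ τ ⟨$⟩ˡ u <? τ ⟨$⟩ˡ w ⌋

  prefix : ∀ {n} → VertexOrder n → Fin n → Fin n → Bool
  prefix σ i u = ⌊ σ ⟨$⟩ˡ u ≤? i ⌋

  size-prefix : ∀ {n} (σ : VertexOrder n) i → size (prefix σ i) ≡ suc (toℕ i)
  size-prefix {n} σ i = begin-equality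
    size (prefix σ i)                        ≡⟨ ∑-permute (𝟙 ∘ prefix σ i) σ ⟩
    sum (λ k → 𝟙 ⌊ σ ⟨$⟩ˡ (σ ⟨$⟩ʳ k) ≤? i ⌋) ≡⟨ sum-cong-≗ (λ k → cong (λ (j : Fin n) → 𝟙 ⌊ j ≤? i ⌋)
                                                                   (Perm.inverseˡ σ {k})) ⟩
    sum (λ (k : Fin n) → 𝟙 ⌊ k ≤? i ⌋)       ≡⟨ count-≤ i ⟩
    suc (toℕ i)                              ∎

  ∑-positions≡sum-vertices : ∀ {n} (π : VertexOrder n) (P : Fin n → Bool) (h : Fin n → ℕ) →
    ∑ n (λ j → if P j then h (π ⟨$⟩ʳ j) else 0) ≡ sum (λ u → 𝟙 (P (π ⟨$⟩ˡ u)) * h u)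
  ∑-positions≡sum-vertices {n} π P h = begin-equality
    ∑ n f                              ≡⟨ ∑≡sum n f ⟩
    sum f                              ≡⟨ ∑-permute f (Perm.flip π) ⟩
    sum (λ u → f (π ⟨$⟩ˡ u))           ≡⟨ sum-cong-≗ (λ u → trans (cong (g u) (Perm.inverseʳ π))
                                                                   (if≡𝟙* _ (h u))) ⟩
    sum (λ u → 𝟙 (P (π ⟨$⟩ˡ u)) * h u) ∎
    where
    f : Fin n → ℕ
    f j = if P j then h (π ⟨$⟩ʳ j) else 0
    g : Fin n → Fin n → ℕ
    g u v = if P (π ⟨$⟩ˡ u) then h v else 0

  module _ {n : ℕ} (G : Multigraph n) where

    degInto : (Fin n → Bool) → Fin n → ℕ
    degInto S w = sum (λ u → 𝟙 (S u) * mult G u w)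

    leftEdges : VertexOrder n → Fin n → Fin n → ℕ
    leftEdges τ w u = 𝟙 (before τ w u) * mult G u w

    leftDeg≡degInto-before : ∀ τ w → leftDeg G τ w ≡ degInto (before τ w) w
    leftDeg≡degInto-before τ w =
      ∑-positions≡sum-vertices τ (λ j → ⌊ j <? τ ⟨$⟩ˡ w ⌋) (λ u → mult G u w)

    remDeg≡degInto-prefix : ∀ σ i w → remDeg G σ i w ≡ degInto (prefix σ i) w
    remDeg≡degInto-prefix σ i w = ∑-positions≡sum-vertices σ (λ j → ⌊ j ≤? i ⌋) (λ u → mult G u w)

    cost≡sum-leftDeg² : ∀ τ → cost G τ ≡ sum (λ w → leftDeg G τ w * leftDeg G τ w)
    cost≡sum-leftDeg² τ = trans (∑≡sum n (λ w → leftDeg G τ w ^ 2))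
      (sum-cong-≗ (λ w → cong (leftDeg G τ w *_) (*-identityʳ (leftDeg G τ w))))

    degInto-mono : ∀ {S S′} → (∀ u → T (S u) → T (S′ u)) → ∀ w → degInto S w ≤ degInto S′ w
    degInto-mono S⊆S′ w = sum-mono-≤ (λ u → *-monoˡ-≤ (mult G u w) (𝟙-mono (S⊆S′ u)))

    mult≤leftEdges+leftEdges : ∀ τ w u → mult G u w ≤ leftEdges τ w u + leftEdges τ u w
    mult≤leftEdges+leftEdges τ w u with τ ⟨$⟩ˡ u <? τ ⟨$⟩ˡ w | τ ⟨$⟩ˡ w <? τ ⟨$⟩ˡ u
    ... | yes _  | _      = ≤-trans (≤-reflexive (sym (*-identityˡ _))) (m≤m+n _ _)
    ... | no _   | yes _  =
      ≤-trans (≤-reflexive (trans (symmetric G u w) (sym (*-identityˡ _)))) (m≤n+m _ 0)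
    ... | no u≮w | no w≮u = ≤-reflexive (trans (cong (λ v → mult G v w) u≡w) (loopFree G w))
      where
      u≡w : u ≡ w
      u≡w = trans (sym (Perm.inverseʳ τ))
              (trans (cong (τ ⟨$⟩ʳ_) (Fin.≤-antisym (≮⇒≥ w≮u) (≮⇒≥ u≮w))) (Perm.inverseʳ τ))

    edge-inside≤leftEdges : ∀ τ (S : Fin n → Bool) w u →
      𝟙 (S w) * (𝟙 (S u) * mult G u w) ≤ 𝟙 (S w) * leftEdges τ w u + 𝟙 (S u) * leftEdges τ u w
    edge-inside≤leftEdges τ S w u with S w | S u
    ... | false | _     = z≤n
    ... | true  | false = z≤n
    ... | true  | true  = begin
      1 * (1 * mult G u w)                      ≡⟨ trans (*-identityˡ _) (*-identityˡ (mult G u w)) ⟩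
      mult G u w                                ≤⟨ mult≤leftEdges+leftEdges τ w u ⟩
      leftEdges τ w u + leftEdges τ u w         ≡⟨ cong₂ _+_ (*-identityˡ (leftEdges τ w u))
                                                             (*-identityˡ (leftEdges τ u w)) ⟨
      1 * leftEdges τ w u + 1 * leftEdges τ u w ∎

    sum-degInto≤2*sum-leftDeg : ∀ τ (S : Fin n → Bool) →
      sum (λ w → 𝟙 (S w) * degInto S w) ≤ 2 * sum (λ w → 𝟙 (S w) * leftDeg G τ w)
    sum-degInto≤2*sum-leftDeg τ S = begin
      sum (λ w → 𝟙 (S w) * degInto S w)
        ≡⟨ sum-cong-≗ (λ w → *-distribˡ-sum (𝟙 (S w)) (λ u → 𝟙 (S u) * mult G u w)) ⟩
      sum₂ (λ w u → 𝟙 (S w) * (𝟙 (S u) * mult G u w))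
        ≤⟨ sum₂-mono-≤ (edge-inside≤leftEdges τ S) ⟩
      sum₂ (λ w u → P w u + P u w)
        ≡⟨ sum₂-+-transpose P ⟩
      2 * sum₂ P
        ≡⟨ cong (2 *_) (sum-cong-≗ sum-P≡𝟙*leftDeg) ⟩
      2 * sum (λ w → 𝟙 (S w) * leftDeg G τ w) ∎
      where
      P : Fin n → Fin n → ℕ
      P w u = 𝟙 (S w) * leftEdges τ w u
      sum-P≡𝟙*leftDeg : ∀ w → sum (P w) ≡ 𝟙 (S w) * leftDeg G τ w
      sum-P≡𝟙*leftDeg w = trans (sym (*-distribˡ-sum (𝟙 (S w)) (leftEdges τ w)))
                                (cong (𝟙 (S w) *_) (sym (leftDeg≡degInto-before τ w)))

    size*minDeg²≤4*cost : ∀ τ (S : Fin n → Bool) d → (∀ w → T (S w) → d ≤ degInto S w) →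
      size S * (d * d) ≤ 4 * cost G τ
    size*minDeg²≤4*cost τ S d minDeg =
      m*d≤2*l⇒l*l≤m*c⇒m*[d*d]≤4*c (size S) d L (cost G τ) size*d≤2L L²≤size*cost
      where
      ℓ = leftDeg G τ
      L = sum (λ w → 𝟙 (S w) * ℓ w)
      size*d≤2L : size S * d ≤ 2 * L
      size*d≤2L = begin
        size S * d                         ≡⟨ *-distribʳ-sum d (𝟙 ∘ S) ⟩
        sum (λ w → 𝟙 (S w) * d)            ≤⟨ sum-mono-≤ (λ w → 𝟙*-monoʳ-≤ (S w) (minDeg w)) ⟩
        sum (λ w → 𝟙 (S w) * degInto S w)  ≤⟨ sum-degInto≤2*sum-leftDeg τ S ⟩
        2 * L                              ∎
      L²≤size*cost : L * L ≤ size S * cost G τ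
      L²≤size*cost = begin
        L * L                                      ≤⟨ cauchy-schwarz (𝟙 ∘ S) ℓ ⟩
        size S * sum (λ w → 𝟙 (S w) * (ℓ w * ℓ w)) ≤⟨ *-monoʳ-≤ (size S)
                                                        (sum-mono-≤ (λ w → 𝟙*m≤m (S w) _)) ⟩
        size S * sum (λ w → ℓ w * ℓ w)             ≡⟨ cong (size S *_) (cost≡sum-leftDeg² τ) ⟨
        size S * cost G τ                          ∎

    greedy-prefix-bound : ∀ σ → IsGreedy G σ → ∀ τ i →
      suc (toℕ i) * (remDeg G σ i (σ ⟨$⟩ʳ i) * remDeg G σ i (σ ⟨$⟩ʳ i)) ≤ 4 * cost G τ
    greedy-prefix-bound σ greedy τ i =
      subst (λ m → m * (d * d) ≤ 4 * cost G τ) (size-prefix σ i)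
        (size*minDeg²≤4*cost τ (prefix σ i) d minDeg)
      where
      d = remDeg G σ i (σ ⟨$⟩ʳ i)
      minDeg : ∀ w → T (prefix σ i w) → d ≤ degInto (prefix σ i) w
      minDeg w w∈S = begin
        d                                 ≤⟨ greedy i (σ ⟨$⟩ˡ w) (toWitness w∈S) ⟩
        remDeg G σ i (σ ⟨$⟩ʳ (σ ⟨$⟩ˡ w))  ≡⟨ cong (remDeg G σ i) (Perm.inverseʳ σ) ⟩
        remDeg G σ i w                    ≡⟨ remDeg≡degInto-prefix σ i w ⟩
        degInto (prefix σ i) w            ∎

    leftDeg≤remDeg : ∀ σ i → leftDeg G σ (σ ⟨$⟩ʳ i) ≤ remDeg G σ i (σ ⟨$⟩ʳ i)
    leftDeg≤remDeg σ i = begin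
      leftDeg G σ v           ≡⟨ leftDeg≡degInto-before σ v ⟩
      degInto (before σ v) v  ≤⟨ degInto-mono earlier⇒prefix v ⟩
      degInto (prefix σ i) v  ≡⟨ remDeg≡degInto-prefix σ i v ⟨
      remDeg G σ i v          ∎
      where
      v = σ ⟨$⟩ʳ i
      earlier⇒prefix : ∀ u → T (before σ v u) → T (prefix σ i u)
      earlier⇒prefix u u<v =
        fromWitness (<⇒≤ (subst (σ ⟨$⟩ˡ u <_) (Perm.inverseˡ σ) (toWitness u<v)))

    cost≤sum-remDeg² : ∀ σ →
      cost G σ ≤ sum (λ i → remDeg G σ i (σ ⟨$⟩ʳ i) * remDeg G σ i (σ ⟨$⟩ʳ i))
    cost≤sum-remDeg² σ = begin
      cost G σ                                ≡⟨ cost≡sum-leftDeg² σ ⟩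
      sum (λ v → ℓ v * ℓ v)                   ≡⟨ ∑-permute (λ v → ℓ v * ℓ v) σ ⟩
      sum (λ i → ℓ (σ ⟨$⟩ʳ i) * ℓ (σ ⟨$⟩ʳ i)) ≤⟨ sum-mono-≤ (λ i → *-mono-≤ (leftDeg≤remDeg σ i)
                                                                          (leftDeg≤remDeg σ i)) ⟩
      sum (λ i → remDeg G σ i (σ ⟨$⟩ʳ i) * remDeg G σ i (σ ⟨$⟩ʳ i)) ∎
      where
      ℓ = leftDeg G σ

module Harmonic where
  import Data.Nat as ℕ
  import Data.Nat.Properties as ℕ
  open import Algebra.Properties.Semiring.Sum ℕ.+-*-semiring using (sum; sum-init-last)
  open import Data.Fin using (Fin; toℕ; inject₁; fromℕ)
  open import Data.Fin.Properties using (toℕ-inject₁; toℕ-fromℕ)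
  open import Data.Nat.Coprimality as Coprime using (Coprime; 1-coprimeTo)
  open import Data.Integer using (+_; +≤+)
  import Data.Integer as ℤ
  import Data.Integer.Properties as ℤ
  open import Data.Rational using (mkℚ; 1ℚ; _/_; _+_; _*_; _≤_; *≤*)
  open import Data.Rational.Properties
    using (normalize-coprime; normalize-nonNeg; /-cong; *-inverseˡ; *-identityʳ; *-zeroˡ;
           *-assoc; *-comm; *-distribʳ-+; +-mono-≤; *-monoʳ-≤-nonNeg; ≤-reflexive;
           module ≤-Reasoning)
  open import Function using (_∘_)
  open import Relation.Binary.PropositionalEquality
    using (_≡_; refl; sym; cong; cong₂; subst; subst₂)
  open ≤-Reasoning

  coprime-1 : ∀ k → Coprime k 1
  coprime-1 k = Coprime.sym (1-coprimeTo k)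

  toℚ≡mkℚ : ∀ k → toℚ k ≡ mkℚ (+ k) 0 (coprime-1 k)
  toℚ≡mkℚ k = normalize-coprime (coprime-1 k)

  toℚ-+ : ∀ a b → toℚ (a ℕ.+ b) ≡ toℚ a + toℚ b
  toℚ-+ a b rewrite toℚ≡mkℚ a | toℚ≡mkℚ b =
    sym (/-cong {p₁ = + a ℤ.* + 1 ℤ.+ + b ℤ.* + 1} {q₁ = 1} {p₂ = + (a ℕ.+ b)} {q₂ = 1}
          (cong₂ ℤ._+_ (ℤ.*-identityʳ (+ a)) (ℤ.*-identityʳ (+ b))) refl)

  toℚ-* : ∀ a b → toℚ (a ℕ.* b) ≡ toℚ a * toℚ b
  toℚ-* a b rewrite toℚ≡mkℚ a | toℚ≡mkℚ b =
    sym (/-cong {p₁ = + a ℤ.* + b} {q₁ = 1} {p₂ = + (a ℕ.* b)} {q₂ = 1} (sym (ℤ.pos-* a b)) refl)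

  toℚ-mono-≤ : ∀ {a b} → a ℕ.≤ b → toℚ a ≤ toℚ b
  toℚ-mono-≤ {a} {b} a≤b rewrite toℚ≡mkℚ a | toℚ≡mkℚ b =
    *≤* (subst₂ ℤ._≤_ (sym (ℤ.*-identityʳ (+ a))) (sym (ℤ.*-identityʳ (+ b))) (+≤+ a≤b))

  1/[1+n]*[1+n]≡1 : ∀ n → ((+ 1) / ℕ.suc n) * toℚ (ℕ.suc n) ≡ 1ℚ
  1/[1+n]*[1+n]≡1 n rewrite toℚ≡mkℚ (ℕ.suc n) | normalize-coprime {1} {n} (1-coprimeTo (ℕ.suc n)) =
    *-inverseˡ (mkℚ (+ ℕ.suc n) 0 (coprime-1 (ℕ.suc n)))

  [1+n]*b≤K⇒b≤K/[1+n] : ∀ n b K → ℕ.suc n ℕ.* b ℕ.≤ K → toℚ b ≤ ((+ 1) / ℕ.suc n) * toℚ K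
  [1+n]*b≤K⇒b≤K/[1+n] n b K [1+n]*b≤K = begin
    toℚ b                        ≡⟨ *-identityʳ (toℚ b) ⟨
    toℚ b * 1ℚ                   ≡⟨ cong (toℚ b *_) (1/[1+n]*[1+n]≡1 n) ⟨
    toℚ b * (r * toℚ (ℕ.suc n))  ≡⟨ cong (toℚ b *_) (*-comm r _) ⟩
    toℚ b * (toℚ (ℕ.suc n) * r)  ≡⟨ *-assoc (toℚ b) _ r ⟨
    (toℚ b * toℚ (ℕ.suc n)) * r  ≡⟨ cong (_* r) (toℚ-* b (ℕ.suc n)) ⟨
    toℚ (b ℕ.* ℕ.suc n) * r      ≤⟨ *-monoʳ-≤-nonNeg r {{normalize-nonNeg 1 (ℕ.suc n)}}
                                      (toℚ-mono-≤ (subst (ℕ._≤ K) (ℕ.*-comm (ℕ.suc n) b) [1+n]*b≤K)) ⟩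
    toℚ K * r                    ≡⟨ *-comm (toℚ K) r ⟩
    r * toℚ K                    ∎
    where
    r = (+ 1) / ℕ.suc n

  harmonic-bound : ∀ {n} K (f : Fin n → ℕ) → (∀ i → ℕ.suc (toℕ i) ℕ.* f i ℕ.≤ K) →
    toℚ (sum f) ≤ η n * toℚ K
  harmonic-bound {ℕ.zero}  K f bound = ≤-reflexive (sym (*-zeroˡ (toℚ K)))
  harmonic-bound {ℕ.suc n} K f bound = begin
    toℚ (sum f)                                  ≡⟨ cong toℚ (sum-init-last f) ⟩
    toℚ (sum (f ∘ inject₁) ℕ.+ f (fromℕ n))      ≡⟨ toℚ-+ (sum (f ∘ inject₁)) (f (fromℕ n)) ⟩
    toℚ (sum (f ∘ inject₁)) + toℚ (f (fromℕ n))  ≤⟨ +-mono-≤ (harmonic-bound K (f ∘ inject₁) bound-init)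
                                                             ([1+n]*b≤K⇒b≤K/[1+n] n _ K bound-last) ⟩
    η n * toℚ K + ((+ 1) / ℕ.suc n) * toℚ K      ≡⟨ *-distribʳ-+ (toℚ K) (η n) _ ⟨
    η (ℕ.suc n) * toℚ K                          ∎
    where
    bound-init : ∀ i → ℕ.suc (toℕ i) ℕ.* f (inject₁ i) ℕ.≤ K
    bound-init i = subst (λ j → ℕ.suc j ℕ.* f (inject₁ i) ℕ.≤ K) (toℕ-inject₁ i) (bound (inject₁ i))
    bound-last : ℕ.suc n ℕ.* f (fromℕ n) ℕ.≤ K
    bound-last = subst (λ j → ℕ.suc j ℕ.* f (fromℕ n) ℕ.≤ K) (toℕ-fromℕ n) (bound (fromℕ n))

open import Data.Rational using (_≤_; _*_)
open import Data.Rational.Properties using (*-assoc; *-comm; module ≤-Reasoning)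
open import Relation.Binary.PropositionalEquality using (cong)
import Data.Nat as ℕ
open import Data.Nat.Properties using (+-*-semiring)
open import Algebra.Properties.Semiring.Sum +-*-semiring using (sum)
open import Data.Fin using (Fin)
open import Data.Fin.Permutation using (_⟨$⟩ʳ_)
open LeftDegrees using (cost≤sum-remDeg²; greedy-prefix-bound)
open Harmonic using (toℚ-mono-≤; toℚ-*; harmonic-bound)

theorem8 : (n : ℕ) (G : Multigraph n) (σ : VertexOrder n) → IsGreedy G σ →
    (τ : VertexOrder n) → toℚ (cost G σ) ≤ (toℚ 4 * η n) * toℚ (cost G τ)
theorem8 n G σ greedy τ = begin
  toℚ (cost G σ)         ≤⟨ toℚ-mono-≤ (cost≤sum-remDeg² G σ) ⟩
  toℚ (sum d²)           ≤⟨ harmonic-bound (4 ℕ.* C) d² (greedy-prefix-bound G σ greedy τ) ⟩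
  η n * toℚ (4 ℕ.* C)    ≡⟨ cong (η n *_) (toℚ-* 4 C) ⟩
  η n * (toℚ 4 * toℚ C)  ≡⟨ *-assoc (η n) (toℚ 4) (toℚ C) ⟨
  (η n * toℚ 4) * toℚ C  ≡⟨ cong (_* toℚ C) (*-comm (η n) (toℚ 4)) ⟩
  (toℚ 4 * η n) * toℚ C  ∎
  where
  open ≤-Reasoning
  C = cost G τ
  d² : Fin n → ℕ
  d² i = remDeg G σ i (σ ⟨$⟩ʳ i) ℕ.* remDeg G σ i (σ ⟨$⟩ʳ i)
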